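{- For every integer $k \ge 2$ there is a set $C \subseteq [2k-2]^{k-1}$ such that both $C$ and its complement $[2k-2]^{k-1}\setminus C$ are solvable sets of the complete graph $K_{k-1}$ with $2k-2$ colors.
   Context: $[q] = \{0,1,\dots,q-1\}$. For a graph $G$ on vertices $v_1,\dots,v_m$, a hat-guessing strategy with $q$ colors assigns to each $v_i$ a function from the colors (in $[q]$) of its neighbors to a guess in $[q]$. A set $S \subseteq [q]^m$ is a solvable set of $G$ with $q$ colors if there is a strategy such that for every color assignment in $S$ at least one vertex guesses its own color correctly. -}

module Defs where

open import Data.Nat using (ℕ)
open import Data.Fin using (Fin)
open import Data.Bool using (Bool; true; false)
open import Data.Product using (Σ; ∃; _×_)
open import Relation.Nullary using (¬_)
open import Relation.Binary.PropositionalEquality using (_≡_; _≢_; refl; sym)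

record Graph (m : ℕ) : Set₁ where
  field
    Adj    : Fin m → Fin m → Set
    Adj-sym    : ∀ {i j} → Adj i j → Adj j i
    Adj-irrefl : ∀ {i} → ¬ Adj i i
open Graph public

K : (m : ℕ) → Graph m
K m = record
  { Adj = λ i j → i ≢ j
  ; Adj-sym = λ p e → p (sym e)
  ; Adj-irrefl = λ p → p refl }

Colouring : ℕ → ℕ → Set
Colouring m q = Fin m → Fin q

-- A hat-guessing strategy: vertex i guesses from a colouring, and its guess
-- depends only on the colours of its neighbours (as a function of them).
record Strategy {m : ℕ} (G : Graph m) (q : ℕ) : Set₁ where
  field
    guess : Fin m → Colouring m q → Fin q
    local : ∀ i (c c′ : Colouring m q) →
            (∀ j → Adj G i j → c j ≡ c′ j) → guess i c ≡ guess i c′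
open Strategy public

Solvable : {m : ℕ} (G : Graph m) (q : ℕ) → (Colouring m q → Set) → Set₁
Solvable G q S = Σ (Strategy G q) λ st →
  ∀ c → S c → ∃ λ i → guess st i c ≡ c i

{-# OPTIONS --safe #-}
-- Player i knows every colour except its own, so it can guess the colour
-- that would make the total colour sum congruent to a target residue r i
-- modulo q; some player is right exactly when the total is ≡ r i for some i.
-- With n players the targets cover n residues, so q ≤ 2n residues split
-- into two halves {0,…,n−1} and {n,…,q−1}, each covered by one strategy.
module Submission where

open import Defs
open import Data.Nat using (ℕ; _≥_; _∸_; _*_; suc; _+_; _<_; _≤_; _<ᵇ_; s≤s)
open import Data.Nat.Properties
  using (+-0-commutativeMonoid; +-assoc; *-comm; +-suc; +-identityʳ; ≤-refl; <-≤-trans; +-cancelˡ-<; m+[n∸m]≡n; <ᵇ⇒<; <⇒<ᵇ; ≮⇒≥)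
open import Data.Nat.DivMod using (_%_; m%n<n; m%n%n≡m%n; %-distribˡ-+; [m+kn]%n≡m%n; m<n⇒m%n≡m)
open import Data.Fin using (Fin; toℕ; fromℕ<; punchIn)
open import Data.Fin.Properties using (toℕ-injective; toℕ-fromℕ<; toℕ<n; punchInᵢ≢i)
open import Data.Vec.Functional using (removeAt)
open import Algebra.Properties.CommutativeMonoid.Sum +-0-commutativeMonoid
  using (sum; sum-remove; sum-cong-≗)
open import Data.Bool using (Bool; true; false; T)
open import Data.Product using (Σ; _×_; _,_; ∃)
open import Function using (_∘_)
open import Relation.Binary.PropositionalEquality

-- q′ * p represents −p modulo suc q′, so adding it undoes the shift by p.
[[m+p]%n+[n∸1]*p]%n≡m : ∀ q′ {m p r} → m < suc q′ →
                        (m + p) % suc q′ ≡ r → (r + q′ * p) % suc q′ ≡ m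
[[m+p]%n+[n∸1]*p]%n≡m q′ {m} {p} m<q refl = begin
    ((m + p) % q + q′ * p) % q
  ≡⟨ %-distribˡ-+ ((m + p) % q) (q′ * p) q ⟩
    ((m + p) % q % q + (q′ * p) % q) % q
  ≡⟨ cong (λ x → (x + (q′ * p) % q) % q) (m%n%n≡m%n (m + p) q) ⟩
    ((m + p) % q + (q′ * p) % q) % q
  ≡⟨ %-distribˡ-+ (m + p) (q′ * p) q ⟨
    (m + p + q′ * p) % q
  ≡⟨ cong (_% q) (trans (+-assoc m p (q′ * p)) (cong (m +_) (*-comm q p))) ⟩
    (m + p * q) % q
  ≡⟨ [m+kn]%n≡m%n m p q ⟩
    m % q
  ≡⟨ m<n⇒m%n≡m m<q ⟩
    m ∎
  where
  open ≡-Reasoning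
  q = suc q′

solvable-mono : ∀ {m q} {G : Graph m} {S S′ : Colouring m q → Set} →
                (∀ c → S′ c → S c) → Solvable G q S → Solvable G q S′
solvable-mono S′⊆S (st , wins) = st , λ c c∈S′ → wins c (S′⊆S c c∈S′)

total : ∀ {n q} → Colouring n q → ℕ
total c = sum (toℕ ∘ c)

othersTotal : ∀ {n q} → Fin (suc n) → Colouring (suc n) q → ℕ
othersTotal i c = sum (removeAt (toℕ ∘ c) i)

othersTotal-local : ∀ {n q} i (c c′ : Colouring (suc n) q) →
                    (∀ j → Adj (K (suc n)) i j → c j ≡ c′ j) →
                    othersTotal i c ≡ othersTotal i c′
othersTotal-local i c c′ agree =
  sum-cong-≗ (λ j → cong toℕ (agree (punchIn i j) (punchInᵢ≢i i j ∘ sym)))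

sumStrategy : ∀ {n q′} → (Fin (suc n) → ℕ) → Strategy (K (suc n)) (suc q′)
sumStrategy {n} {q′} r = record
  { guess = λ i c → target i (othersTotal i c)
  ; local = λ i c c′ agree → cong (target i) (othersTotal-local i c c′ agree)
  }
  where
  target : Fin (suc n) → ℕ → Fin (suc q′)
  target i p = fromℕ< (m%n<n (r i + q′ * p) (suc q′))

sumStrategy-correct : ∀ {n q′} (r : Fin (suc n) → ℕ) (c : Colouring (suc n) (suc q′)) i →
                      total c % suc q′ ≡ r i → guess (sumStrategy r) i c ≡ c i
sumStrategy-correct {q′ = q′} r c i total≡r = toℕ-injective (begin
    toℕ (guess (sumStrategy r) i c)
  ≡⟨ toℕ-fromℕ< _ ⟩
    (r i + q′ * othersTotal i c) % suc q′
  ≡⟨ [[m+p]%n+[n∸1]*p]%n≡m q′ (toℕ<n (c i))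
       (trans (cong (_% suc q′) (sym (sum-remove (toℕ ∘ c)))) total≡r) ⟩
    toℕ (c i) ∎)
  where open ≡-Reasoning

sumStrategy-solvable : ∀ {n q′} (r : Fin (suc n) → ℕ) →
                       Solvable (K (suc n)) (suc q′) (λ c → ∃ λ i → total c % suc q′ ≡ r i)
sumStrategy-solvable r =
  sumStrategy r , λ c (i , total≡r) → i , sumStrategy-correct r c i total≡r

<⇒≡toℕ : ∀ {n s} → s < n → ∃ λ (i : Fin n) → s ≡ toℕ i
<⇒≡toℕ s<n = fromℕ< s<n , sym (toℕ-fromℕ< s<n)

≤∧<+⇒≡+toℕ : ∀ {n s} → n ≤ s → s < n + n → ∃ λ (i : Fin n) → s ≡ n + toℕ i
≤∧<+⇒≡+toℕ {n} {s} n≤s s<2n = fromℕ< s∸n<n ,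
  trans (sym (m+[n∸m]≡n n≤s)) (cong (n +_) (sym (toℕ-fromℕ< s∸n<n)))
  where
  s∸n<n : s ∸ n < n
  s∸n<n = +-cancelˡ-< n (s ∸ n) n (subst (_< n + n) (sym (m+[n∸m]≡n n≤s)) s<2n)

HasSolvableBipartition : ℕ → ℕ → Set₁
HasSolvableBipartition m q = Σ (Colouring m q → Bool) λ C →
  Solvable (K m) q (λ c → C c ≡ true) × Solvable (K m) q (λ c → C c ≡ false)

complete-hasSolvableBipartition : ∀ n q′ → suc q′ ≤ suc n + suc n →
                                  HasSolvableBipartition (suc n) (suc q′)
complete-hasSolvableBipartition n q′ q≤2n = lowHalf ,
  solvable-mono (λ c low → <⇒≡toℕ (<ᵇ⇒< _ _ (subst T (sym low) _)))
    (sumStrategy-solvable toℕ) ,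
  solvable-mono (λ c high → ≤∧<+⇒≡+toℕ (≮⇒≥ (λ p → subst T high (<⇒<ᵇ p)))
                                        (<-≤-trans (m%n<n (total c) (suc q′)) q≤2n))
    (sumStrategy-solvable (λ i → suc n + toℕ i))
  where
  lowHalf : Colouring (suc n) (suc q′) → Bool
  lowHalf c = total c % suc q′ <ᵇ suc n

2[2+m]∸2≡1+[m+1+m] : ∀ m → 2 * suc (suc m) ∸ 2 ≡ suc (m + suc m)
2[2+m]∸2≡1+[m+1+m] m = trans (cong (λ x → m + suc (suc x)) (+-identityʳ m)) (+-suc m (suc m))

mainTheorem13 : (k : ℕ) → k ≥ 2 →
    Σ (Colouring (k ∸ 1) (2 * k ∸ 2) → Bool) λ C →
    Solvable (K (k ∸ 1)) (2 * k ∸ 2) (λ c → C c ≡ true)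
    × Solvable (K (k ∸ 1)) (2 * k ∸ 2) (λ c → C c ≡ false)
mainTheorem13 (suc (suc m)) (s≤s (s≤s _)) =
  subst (HasSolvableBipartition (suc m)) (sym (2[2+m]∸2≡1+[m+1+m] m))
    (complete-hasSolvableBipartition m (m + suc m) ≤-refl)
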